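{- Let $\mathcal{F}$ be an odd-cycle-agreeing family of subgraphs of $K_n$. Let $e_0,e_1,\dots,e_{k-1}$ be edges of $K_n$, set $\mathcal{F}_0=\mathcal{F}$ and $\mathcal{F}_{j+1}=C_{e_j}(\mathcal{F}_j)$ for $0\le j<k$, and suppose that $\mathcal{F}_k$ is a $\triangle$umvirate. Then $\mathcal{F}$ is a triangle junta.
   Context: Subgraphs of $K_n$ are identified with their edge sets; $\oplus$ is symmetric difference and $\overline{G}$ the complement in $K_n$. A family $\mathcal{F}$ is odd-cycle-agreeing if for all $G,H\in\mathcal{F}$, $\overline{G\oplus H}$ contains an odd cycle. For an edge $e$ and a family $\mathcal{A}$, the monotonization $C_e(\mathcal{A})$ is obtained from $\mathcal{A}$ by replacing $A$ with $A\cup\{e\}$ for each $A\in\mathcal{A}$ such that $e\notin A$ and $A\cup\{e\}\notin\mathcal{A}$. A $\triangle$umvirate is the family of all subgraphs of $K_n$ containing a fixed triangle; a triangle junta is a family $\{G: G\cap T=S\}$ for a fixed triangle $T$ and fixed $S\subseteq T$. -}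

module Defs where

open import Data.Nat using (ℕ; zero; suc; _+_; _*_)
open import Data.Bool using (Bool; true; false; _∧_; _∨_; not; _xor_; if_then_else_)
import Data.Bool.Properties as BoolP
open import Data.Fin using (Fin; zero; suc; inject₁; fromℕ)
open import Data.Vec using (Vec; []; _∷_; lookup; tabulate; zipWith)
import Data.Vec.Properties as VecP
open import Data.List using (List; []; _∷_; map)
open import Data.Bool.ListAction using (any)
open import Data.List.Membership.Propositional using (_∈_)
open import Data.Unit using (⊤; tt)
open import Data.Empty using (⊥)
open import Data.Sum using (_⊎_; inj₁; inj₂)
open import Data.Product using (Σ; _×_; _,_; ∃; ∃-syntax)
open import Function.Definitions using (Injective)
open import Function.Bundles using (_⇔_)
open import Relation.Nullary using (¬_; Dec; yes; no; does)
open import Relation.Binary.PropositionalEquality using (_≡_; _≢_; refl; cong₂)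

-- A subgraph of K_n (= an edge set) is
-- represented canonically: vertex 0 is the "newest" vertex, and
-- Graph (suc n) = (adjacency of vertex 0 to vertices 1..n) × (graph on
-- vertices 1..n).  Each simple graph on Fin n has exactly one code.

Graph : ℕ → Set
Graph zero    = ⊤
Graph (suc n) = Vec Bool n × Graph n

-- Edges of K_n: inj₁ j is the edge {0, suc j}; inj₂ e is an edge among
-- the vertices 1..n.
Edge : ℕ → Set
Edge zero    = ⊥
Edge (suc n) = Fin n ⊎ Edge n

adj : ∀ {n} → Graph n → Fin n → Fin n → Bool
adj {suc n} (v , g) zero    zero    = false
adj {suc n} (v , g) zero    (suc j) = lookup v j
adj {suc n} (v , g) (suc i) zero    = lookup v i
adj {suc n} (v , g) (suc i) (suc j) = adj g i j

hasEdge : ∀ {n} → Graph n → Edge n → Bool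
hasEdge {suc n} (v , g) (inj₁ j) = lookup v j
hasEdge {suc n} (v , g) (inj₂ e) = hasEdge g e

-- the graph with exactly the pairs {i,j}, i ≠ j, for which f i j holds
-- (f is read on the pair (i,j) with i before j in the encoding)
tabG : ∀ {n} → (Fin n → Fin n → Bool) → Graph n
tabG {zero}  f = tt
tabG {suc n} f = tabulate (λ j → f zero (suc j)) , tabG (λ i j → f (suc i) (suc j))

zipG : ∀ {n} → (Bool → Bool → Bool) → Graph n → Graph n → Graph n
zipG {zero}  op g h = tt
zipG {suc n} op (v , g) (w , h) = zipWith op v w , zipG op g h

mapG : ∀ {n} → (Bool → Bool) → Graph n → Graph n
mapG {zero}  f g = tt
mapG {suc n} f (v , g) = Data.Vec.map f v , mapG f g

_∪G_ _∩G_ _⊕G_ : ∀ {n} → Graph n → Graph n → Graph n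
g ∪G h = zipG _∨_ g h
g ∩G h = zipG _∧_ g h
g ⊕G h = zipG _xor_ g h

compl : ∀ {n} → Graph n → Graph n
compl g = mapG not g

_⊆G_ : ∀ {n} → Graph n → Graph n → Set
_⊆G_ {n} g h = (e : Edge n) → hasEdge g e ≡ true → hasEdge h e ≡ true

addEdge : ∀ {n} → Graph n → Edge n → Graph n
addEdge {suc n} (v , g) (inj₁ j) = Data.Vec.updateAt v j (λ _ → true) , g
addEdge {suc n} (v , g) (inj₂ e) = v , addEdge g e

_≟G_ : ∀ {n} (g h : Graph n) → Dec (g ≡ h)
_≟G_ {zero}  tt tt = yes refl
_≟G_ {suc n} (v , g) (w , h) with VecP.≡-dec BoolP._≟_ v w | g ≟G h
... | yes refl | yes refl = yes refl
... | no ¬p    | _        = no (λ { refl → ¬p refl })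
... | yes _    | no ¬q    = no (λ { refl → ¬q refl })

-- Families of subgraphs: finite lists (read as sets, via _∈_).

Family : ℕ → Set
Family n = List (Graph n)

memb : ∀ {n} → Graph n → Family n → Bool
memb g 𝒜 = any (λ h → does (g ≟G h)) 𝒜

shiftTo : ∀ {n} → Edge n → Family n → Graph n → Graph n
shiftTo e 𝒜 A =
  if hasEdge A e then A
  else (if memb (addEdge A e) 𝒜 then A else addEdge A e)

Cmon : ∀ {n} → Edge n → Family n → Family n
Cmon e 𝒜 = map (shiftTo e 𝒜) 𝒜

iterC : ∀ {n} → List (Edge n) → Family n → Family n
iterC []       F = F
iterC (e ∷ es) F = iterC es (Cmon e F)

-- Odd cycles: an injective cyclic sequence c_0,…,c_{m-1} of vertices,
-- m = 2t+3 (odd, ≥ 3), with consecutive vertices (cyclically) adjacent.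

HasOddCycle : ∀ {n} → Graph n → Set
HasOddCycle {n} G =
  Σ ℕ λ t → Σ (Fin (suc (suc (suc (t + t)))) → Fin n) λ c →
    Injective _≡_ _≡_ c
    × ((i : Fin (suc (suc (t + t)))) → adj G (c (inject₁ i)) (c (suc i)) ≡ true)
    × adj G (c (fromℕ (suc (suc (t + t))))) (c zero) ≡ true

OddCycleAgreeing : ∀ {n} → Family n → Set
OddCycleAgreeing F = ∀ G H → G ∈ F → H ∈ F → HasOddCycle (compl (G ⊕G H))

IsTriangle : ∀ {n} → Fin n → Fin n → Fin n → Set
IsTriangle a b c = a ≢ b × b ≢ c × a ≢ c

inTri : ∀ {n} → Fin n → Fin n → Fin n → Fin n → Bool
inTri a b c i = does (i Data.Fin.≟ a) ∨ does (i Data.Fin.≟ b) ∨ does (i Data.Fin.≟ c)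

triangle : ∀ {n} → Fin n → Fin n → Fin n → Graph n
triangle a b c = tabG (λ i j → inTri a b c i ∧ inTri a b c j)

IsTriangleUmvirate : ∀ {n} → Family n → Set
IsTriangleUmvirate {n} F =
  ∃[ a ] ∃[ b ] ∃[ c ] (IsTriangle a b c
    × ((G : Graph n) → (G ∈ F) ⇔ (triangle a b c ⊆G G)))

IsTriangleJunta : ∀ {n} → Family n → Set
IsTriangleJunta {n} F =
  ∃[ a ] ∃[ b ] ∃[ c ] (IsTriangle a b c
    × Σ (Graph n) λ S → (S ⊆G triangle a b c)
      × ((G : Graph n) → (G ∈ F) ⇔ (G ∩G triangle a b c ≡ S)))

module Submission where

-- A triangle umvirate is the junta of S = T on the triangle T, so it suffices to pull a
-- junta on a fixed triangle T back along one monotonization C_e of an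
-- odd-cycle-agreeing family F; C_e keeps F odd-cycle-agreeing, so this iterates.
-- If e ∉ T, the junta condition does not see e and F is the same junta.  If e ∈ T,
-- every member of the junta C_e(F) contains e, and the members of F agreeing with S
-- on T are closed under flipping any edge g ∉ T: otherwise F has two members whose
-- agreement graph lies inside (T − e) + g, which is bipartite, contradicting
-- odd-cycle-agreement.  Hence F contains either all graphs agreeing with S on T, and is
-- their junta, or none of them, and is then the junta of S − e.

open import Defs
open import Data.Nat using (ℕ; zero; suc; _+_; s≤s; z≤n)
open import Data.Nat.Properties as ℕₚ using (+-suc; n<1+n)
open import Data.Bool using (Bool; true; false; not; _xor_; _∧_; _∨_; if_then_else_)
open import Data.Bool.Properties
  using (not-¬; ¬-not; ∧-conicalˡ; ∧-conicalʳ; not-distribʳ-xor; not-involutive; xor-identityʳ; xor-comm; ∧-identityʳ; ∧-zeroʳ)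
  renaming (_≟_ to _≟B_)
open import Data.Fin as Fin using (Fin; zero; suc; toℕ; inject₁; fromℕ)
open import Data.Fin.Patterns using (0F; 1F; 2F; 3F)
open import Data.Fin.Properties as Finₚ using (<⇒≢; <-asym; toℕ-fromℕ; toℕ-inject₁; pigeonhole)
open import Data.Vec as Vec using ([]; _∷_; lookup)
import Data.Vec.Properties as Vecₚ
open import Data.List using (List; []; _∷_; map; _++_; allFin)
open import Data.List.Membership.Propositional using (_∈_; _∉_)
open import Data.List.Membership.Propositional.Properties
  using (∈-map⁺; ∈-map⁻; ∈-++⁺ˡ; ∈-++⁺ʳ; ∈-allFin)
open import Data.List.Relation.Unary.Any using (here; there)
open import Data.Empty using (⊥; ⊥-elim)
open import Data.Sum as Sum using (_⊎_; inj₁; inj₂; [_,_]; [_,_]′)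
open import Data.Product using (Σ-syntax; _×_; _,_; ∃-syntax; proj₁; proj₂)
open import Function using (id; _∘_)
open import Function.Bundles using (_⇔_; mk⇔; Equivalence)
open import Function.Construct.Composition using (_⇔-∘_)
open import Relation.Nullary using (¬_; Dec; yes; no; does; contradiction)
open import Relation.Binary.PropositionalEquality
  using (_≡_; _≢_; refl; sym; trans; cong; cong₂; subst; subst₂; module ≡-Reasoning)

open Equivalence using (to; from)

src dst : ∀ {n} → Edge n → Fin n
src {suc n} (inj₁ j) = zero
src {suc n} (inj₂ e) = suc (src e)
dst {suc n} (inj₁ j) = suc j
dst {suc n} (inj₂ e) = suc (dst e)

src<dst : ∀ {n} (e : Edge n) → src e Fin.< dst e
src<dst {suc n} (inj₁ j) = s≤s z≤n
src<dst {suc n} (inj₂ e) = s≤s (src<dst e)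

src≢dst : ∀ {n} (e : Edge n) → src e ≢ dst e
src≢dst e = <⇒≢ (src<dst e)

src-dst-injective : ∀ {n} {e f : Edge n} → src e ≡ src f → dst e ≡ dst f → e ≡ f
src-dst-injective {suc n} {inj₁ i} {inj₁ j} _ refl = refl
src-dst-injective {suc n} {inj₂ e} {inj₂ f} p q =
  cong inj₂ (src-dst-injective (Finₚ.suc-injective p) (Finₚ.suc-injective q))

_≟E_ : ∀ {n} (e f : Edge n) → Dec (e ≡ f)
e ≟E f with src e Fin.≟ src f | dst e Fin.≟ dst f
... | yes p | yes q = yes (src-dst-injective p q)
... | no ¬p | _     = no (¬p ∘ cong src)
... | yes _ | no ¬q = no (¬q ∘ cong dst)

allEdges : ∀ n → List (Edge n)
allEdges zero    = []
allEdges (suc n) = map inj₁ (allFin n) ++ map inj₂ (allEdges n)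

∈-allEdges : ∀ {n} (e : Edge n) → e ∈ allEdges n
∈-allEdges {suc n} (inj₁ j) = ∈-++⁺ˡ (∈-map⁺ inj₁ (∈-allFin j))
∈-allEdges {suc n} (inj₂ e) = ∈-++⁺ʳ (map inj₁ (allFin n)) (∈-map⁺ inj₂ (∈-allEdges e))

graph-ext : ∀ {n} {G H : Graph n} → (∀ f → hasEdge G f ≡ hasEdge H f) → G ≡ H
graph-ext {zero}              _ = refl
graph-ext {suc n} {v , G} {w , H} p = cong₂ _,_ vec-ext (graph-ext (p ∘ inj₂))
  where
  vec-ext : v ≡ w
  vec-ext = trans (sym (Vecₚ.tabulate∘lookup v))
                  (trans (Vecₚ.tabulate-cong (p ∘ inj₁)) (Vecₚ.tabulate∘lookup w))

graph-ext-at : ∀ {n} {G H : Graph n} e → hasEdge G e ≡ hasEdge H e →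
               (∀ f → f ≢ e → hasEdge G f ≡ hasEdge H f) → G ≡ H
graph-ext-at {G = G} {H} e at off = graph-ext agree
  where
  agree : ∀ f → hasEdge G f ≡ hasEdge H f
  agree f with f ≟E e
  ... | yes refl = at
  ... | no f≢e   = off f f≢e

setEdge : ∀ {n} → Graph n → Edge n → Bool → Graph n
setEdge {suc n} (v , G) (inj₁ j) b = Vec.updateAt v j (λ _ → b) , G
setEdge {suc n} (v , G) (inj₂ e) b = v , setEdge G e b

removeEdge flipEdge : ∀ {n} → Graph n → Edge n → Graph n
removeEdge G e = setEdge G e false
flipEdge   G e = setEdge G e (not (hasEdge G e))

hasEdge-setEdge-≡ : ∀ {n} (G : Graph n) e b → hasEdge (setEdge G e b) e ≡ b
hasEdge-setEdge-≡ {suc n} (v , G) (inj₁ j) b = Vecₚ.lookup∘updateAt j v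
hasEdge-setEdge-≡ {suc n} (v , G) (inj₂ e) b = hasEdge-setEdge-≡ G e b

hasEdge-setEdge-≢ : ∀ {n} (G : Graph n) {e f} b → f ≢ e → hasEdge (setEdge G e b) f ≡ hasEdge G f
hasEdge-setEdge-≢ {suc n} (v , G) {inj₁ j} {inj₁ i} b f≢e =
  Vecₚ.lookup∘updateAt′ i j (f≢e ∘ cong inj₁) v
hasEdge-setEdge-≢ {suc n} (v , G) {inj₁ j} {inj₂ f} b f≢e = refl
hasEdge-setEdge-≢ {suc n} (v , G) {inj₂ e} {inj₁ i} b f≢e = refl
hasEdge-setEdge-≢ {suc n} (v , G) {inj₂ e} {inj₂ f} b f≢e =
  hasEdge-setEdge-≢ G b (f≢e ∘ cong inj₂)

setEdge-hasEdge : ∀ {n} (G : Graph n) e → setEdge G e (hasEdge G e) ≡ G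
setEdge-hasEdge G e = graph-ext-at e (hasEdge-setEdge-≡ G e _) (λ f → hasEdge-setEdge-≢ G _)

setEdge-setEdge : ∀ {n} (G : Graph n) e b b′ → setEdge (setEdge G e b) e b′ ≡ setEdge G e b′
setEdge-setEdge G e b b′ =
  graph-ext-at e (trans (hasEdge-setEdge-≡ _ e b′) (sym (hasEdge-setEdge-≡ G e b′)))
    λ f f≢e → trans (hasEdge-setEdge-≢ _ b′ f≢e)
                (trans (hasEdge-setEdge-≢ G b f≢e) (sym (hasEdge-setEdge-≢ G b′ f≢e)))

addEdge≡setEdge : ∀ {n} (G : Graph n) e → addEdge G e ≡ setEdge G e true
addEdge≡setEdge {suc n} (v , G) (inj₁ j) = refl
addEdge≡setEdge {suc n} (v , G) (inj₂ e) = cong (v ,_) (addEdge≡setEdge G e)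

hasEdge-addEdge-≡ : ∀ {n} (G : Graph n) e → hasEdge (addEdge G e) e ≡ true
hasEdge-addEdge-≡ G e rewrite addEdge≡setEdge G e = hasEdge-setEdge-≡ G e true

hasEdge-addEdge-≢ : ∀ {n} (G : Graph n) {e f} → f ≢ e → hasEdge (addEdge G e) f ≡ hasEdge G f
hasEdge-addEdge-≢ G {e} f≢e rewrite addEdge≡setEdge G e = hasEdge-setEdge-≢ G true f≢e

addEdge-existing : ∀ {n} {G : Graph n} {e} → hasEdge G e ≡ true → addEdge G e ≡ G
addEdge-existing {G = G} {e} h = begin
  addEdge G e                ≡⟨ addEdge≡setEdge G e ⟩
  setEdge G e true           ≡⟨ cong (setEdge G e) (sym h) ⟩
  setEdge G e (hasEdge G e)  ≡⟨ setEdge-hasEdge G e ⟩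
  G                          ∎
  where open ≡-Reasoning

removeEdge-addEdge : ∀ {n} {G : Graph n} {e} → hasEdge G e ≡ false → removeEdge (addEdge G e) e ≡ G
removeEdge-addEdge {G = G} {e} h = begin
  setEdge (addEdge G e) e false      ≡⟨ cong (λ X → setEdge X e false) (addEdge≡setEdge G e) ⟩
  setEdge (setEdge G e true) e false ≡⟨ setEdge-setEdge G e true false ⟩
  setEdge G e false                  ≡⟨ cong (setEdge G e) (sym h) ⟩
  setEdge G e (hasEdge G e)          ≡⟨ setEdge-hasEdge G e ⟩
  G                                  ∎
  where open ≡-Reasoning

addEdge-preserves-agreement : ∀ {n} (G H : Graph n) e {f} → hasEdge G f ≡ hasEdge H f →
                              hasEdge (addEdge G e) f ≡ hasEdge (addEdge H e) f
addEdge-preserves-agreement G H e {f} G≡H with f ≟E e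
... | yes refl = trans (hasEdge-addEdge-≡ G e) (sym (hasEdge-addEdge-≡ H e))
... | no f≢e   = trans (hasEdge-addEdge-≢ G f≢e) (trans G≡H (sym (hasEdge-addEdge-≢ H f≢e)))

hasEdge-zipG : ∀ {n} op (G H : Graph n) f → hasEdge (zipG op G H) f ≡ op (hasEdge G f) (hasEdge H f)
hasEdge-zipG {suc n} op (v , G) (w , H) (inj₁ j) = Vecₚ.lookup-zipWith op j v w
hasEdge-zipG {suc n} op (v , G) (w , H) (inj₂ e) = hasEdge-zipG op G H e

hasEdge-mapG : ∀ {n} φ (G : Graph n) f → hasEdge (mapG φ G) f ≡ φ (hasEdge G f)
hasEdge-mapG {suc n} φ (v , G) (inj₁ j) = Vecₚ.lookup-map j φ v
hasEdge-mapG {suc n} φ (v , G) (inj₂ e) = hasEdge-mapG φ G e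

hasEdge-tabG : ∀ {n} (φ : Fin n → Fin n → Bool) f → hasEdge (tabG φ) f ≡ φ (src f) (dst f)
hasEdge-tabG {suc n} φ (inj₁ j) = Vecₚ.lookup∘tabulate _ j
hasEdge-tabG {suc n} φ (inj₂ e) = hasEdge-tabG (λ i j → φ (suc i) (suc j)) e

memb⇒∈ : ∀ {n} {G : Graph n} {F} → memb G F ≡ true → G ∈ F
memb⇒∈ {G = G} {H ∷ F} m with G ≟G H
... | yes G≡H = here G≡H
... | no _    = there (memb⇒∈ m)

memb⇒∉ : ∀ {n} {G : Graph n} {F} → memb G F ≡ false → G ∉ F
memb⇒∉ {G = G} {H ∷ F} m G∈ with G ≟G H | G∈
... | yes _  | _         = contradiction m λ ()
... | no G≢H | here G≡H  = G≢H G≡H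
... | no _   | there G∈F = memb⇒∉ m G∈F

-- Agreement on a set of edges, and juntas

_≈[_]_ : ∀ {n} → Graph n → Graph n → Graph n → Set
G ≈[ T ] H = ∀ f → hasEdge T f ≡ true → hasEdge G f ≡ hasEdge H f

≈-refl : ∀ {n} {T G : Graph n} → G ≈[ T ] G
≈-refl f _ = refl

≈-sym : ∀ {n} {T G H : Graph n} → G ≈[ T ] H → H ≈[ T ] G
≈-sym G≈H f f∈T = sym (G≈H f f∈T)

≈-trans : ∀ {n} {T G H K : Graph n} → G ≈[ T ] H → H ≈[ T ] K → G ≈[ T ] K
≈-trans G≈H H≈K f f∈T = trans (G≈H f f∈T) (H≈K f f∈T)

≈-off : ∀ {n} {T G H : Graph n} {e} → hasEdge T e ≡ false →
        (∀ f → f ≢ e → hasEdge G f ≡ hasEdge H f) → G ≈[ T ] H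
≈-off e∉T off f f∈T = off f λ { refl → contradiction (trans (sym e∉T) f∈T) λ () }

setEdge-≈ : ∀ {n} {T : Graph n} {g} (G : Graph n) b → hasEdge T g ≡ false → setEdge G g b ≈[ T ] G
setEdge-≈ G b g∉T = ≈-off g∉T λ f → hasEdge-setEdge-≢ G b

Junta : ∀ {n} → Graph n → Graph n → Family n → Set
Junta T S F = ∀ G → (G ∈ F) ⇔ (G ≈[ T ] S)

module FlipConnected {n} (T : Graph n) (P : Graph n → Set)
         (flip-closed : ∀ {G} g → hasEdge T g ≡ false → P G → P (flipEdge G g)) where

  setEdge-closed : ∀ {G} g b → hasEdge T g ≡ false → P G → P (setEdge G g b)
  setEdge-closed {G} g b g∉T PG with b ≟B hasEdge G g
  ... | yes refl = subst P (sym (setEdge-hasEdge G g)) PG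
  ... | no b≢g   = subst P (cong (setEdge G g) (sym (¬-not b≢g))) (flip-closed g g∉T PG)

  private
    ∉-∷ : ∀ {f g : Edge n} {L} → f ≢ g → f ∉ L → f ∉ g ∷ L
    ∉-∷ f≢g _   (here f≡g)  = f≢g f≡g
    ∉-∷ _   f∉L (there f∈L) = f∉L f∈L

  closed-except : ∀ L {G H} → P G → H ≈[ T ] G → (∀ f → f ∉ L → hasEdge H f ≡ hasEdge G f) → P H
  closed-except []      PG _   off = subst P (graph-ext λ f → sym (off f λ ())) PG
  closed-except (g ∷ L) {G} {H} PG H≈G off with hasEdge T g in g∈T
  ... | true  = closed-except L PG H≈G off′
    where
    off′ : ∀ f → f ∉ L → hasEdge H f ≡ hasEdge G f
    off′ f f∉L with f ≟E g
    ... | yes refl = H≈G f g∈T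
    ... | no f≢g   = off f (∉-∷ f≢g f∉L)
  ... | false = subst P (trans (setEdge-setEdge H g _ _) (setEdge-hasEdge H g))
                  (setEdge-closed g (hasEdge H g) g∈T (closed-except L PG H′≈G off′))
    where
    H′ : Graph n
    H′ = setEdge H g (hasEdge G g)
    H′≈G : H′ ≈[ T ] G
    H′≈G = ≈-trans (setEdge-≈ H _ g∈T) H≈G
    off′ : ∀ f → f ∉ L → hasEdge H′ f ≡ hasEdge G f
    off′ f f∉L with f ≟E g
    ... | yes refl = hasEdge-setEdge-≡ H g _
    ... | no f≢g   = trans (hasEdge-setEdge-≢ H _ f≢g) (off f (∉-∷ f≢g f∉L))

  ≈-closed : ∀ {G H} → P G → H ≈[ T ] G → P H
  ≈-closed PG H≈G = closed-except (allEdges n) PG H≈G λ f f∉ → contradiction (∈-allEdges f) f∉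

open FlipConnected using (≈-closed)

flipOutside : ∀ {n} → Graph n → Graph n → Graph n
flipOutside T G = G ⊕G compl T

hasEdge-flipOutside : ∀ {n} (T G : Graph n) f →
                      hasEdge (flipOutside T G) f ≡ hasEdge G f xor not (hasEdge T f)
hasEdge-flipOutside T G f =
  trans (hasEdge-zipG _xor_ G (compl T) f) (cong (hasEdge G f xor_) (hasEdge-mapG not T f))

flipOutside-≈ : ∀ {n} {T : Graph n} (G : Graph n) → flipOutside T G ≈[ T ] G
flipOutside-≈ {T = T} G f f∈T =
  trans (hasEdge-flipOutside T G f) (trans (cong (λ t → hasEdge G f xor not t) f∈T) (xor-identityʳ _))

flipOutside-∉ : ∀ {n} {T : Graph n} (G : Graph n) {f} → hasEdge T f ≡ false →
                hasEdge (flipOutside T G) f ≡ not (hasEdge G f)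
flipOutside-∉ {T = T} G {f} f∉T =
  trans (hasEdge-flipOutside T G f)
        (trans (cong (λ t → hasEdge G f xor not t) f∉T) (xor-comm (hasEdge G f) true))

addEdge-≈ : ∀ {n} {T S G : Graph n} {e} → hasEdge S e ≡ true →
            G ≈[ T ] removeEdge S e → addEdge G e ≈[ T ] S
addEdge-≈ {S = S} {G} {e} e∈S G≈ f f∈T with f ≟E e
... | yes refl = trans (hasEdge-addEdge-≡ G e) (sym e∈S)
... | no f≢e   = trans (hasEdge-addEdge-≢ G f≢e) (trans (G≈ f f∈T) (hasEdge-setEdge-≢ S false f≢e))

removeEdge-≈ : ∀ {n} {T S G : Graph n} {e} → hasEdge G e ≡ false →
               addEdge G e ≈[ T ] S → G ≈[ T ] removeEdge S e
removeEdge-≈ {S = S} {G} {e} e∉G G+e≈ f f∈T with f ≟E e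
... | yes refl = trans e∉G (sym (hasEdge-setEdge-≡ S e false))
... | no f≢e   = trans (sym (hasEdge-addEdge-≢ G f≢e))
                   (trans (G+e≈ f f∈T) (sym (hasEdge-setEdge-≢ S false f≢e)))

hasEdge-∩-∈ : ∀ {n} {T : Graph n} (G : Graph n) {f} → hasEdge T f ≡ true → hasEdge (G ∩G T) f ≡ hasEdge G f
hasEdge-∩-∈ {T = T} G {f} f∈T =
  trans (hasEdge-zipG _∧_ G T f) (trans (cong (hasEdge G f ∧_) f∈T) (∧-identityʳ _))

hasEdge-∩-∉ : ∀ {n} {T : Graph n} (G : Graph n) {f} → hasEdge T f ≡ false → hasEdge (G ∩G T) f ≡ false
hasEdge-∩-∉ {T = T} G {f} f∉T =
  trans (hasEdge-zipG _∧_ G T f) (trans (cong (hasEdge G f ∧_) f∉T) (∧-zeroʳ _))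

≈⇔∩≡ : ∀ {n} {T G S : Graph n} → (G ≈[ T ] S) ⇔ (G ∩G T ≡ S ∩G T)
≈⇔∩≡ {T = T} {G} {S} = mk⇔ (λ G≈S → graph-ext (restrict G≈S)) λ G∩≡S∩ f f∈T →
  trans (sym (hasEdge-∩-∈ G f∈T)) (trans (cong (λ X → hasEdge X f) G∩≡S∩) (hasEdge-∩-∈ S f∈T))
  where
  restrict : G ≈[ T ] S → ∀ f → hasEdge (G ∩G T) f ≡ hasEdge (S ∩G T) f
  restrict G≈S f with hasEdge T f in f∈T
  ... | true  = trans (hasEdge-∩-∈ G f∈T) (trans (G≈S f f∈T) (sym (hasEdge-∩-∈ S f∈T)))
  ... | false = trans (hasEdge-∩-∉ G f∈T) (sym (hasEdge-∩-∉ S f∈T))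

∩-⊆ : ∀ {n} (S T : Graph n) → (S ∩G T) ⊆G T
∩-⊆ S T f p = ∧-conicalʳ _ _ (trans (sym (hasEdge-zipG _∧_ S T f)) p)

⊆⇔≈ : ∀ {n} {T G : Graph n} → (T ⊆G G) ⇔ (G ≈[ T ] T)
⊆⇔≈ = mk⇔ (λ T⊆G f f∈T → trans (T⊆G f f∈T) (sym f∈T)) (λ G≈T f f∈T → trans (G≈T f f∈T) f∈T)

-- Odd cycles and 2-colourings

_separates_ : ∀ {n} → (Fin n → Bool) → Edge n → Set
χ separates f = χ (src f) ≢ χ (dst f)

ProperColouring : ∀ {n} → Graph n → (Fin n → Bool) → Set
ProperColouring {n} X χ = ∀ f → hasEdge X f ≡ true → χ separates f

adj-proper : ∀ {n} {X : Graph n} {χ} → ProperColouring X χ → ∀ i j → adj X i j ≡ true → χ i ≢ χ j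
adj-proper {suc n} {v , X}     proper zero    zero    ()
adj-proper {suc n} {v , X}     proper zero    (suc j) p = proper (inj₁ j) p
adj-proper {suc n} {v , X}     proper (suc i) zero    p = proper (inj₁ i) p ∘ sym
adj-proper {suc n} {v , X} {χ} proper (suc i) (suc j) p = adj-proper {X = X} {χ ∘ suc} (proper ∘ inj₂) i j p

adj-mono : ∀ {n} {X Y : Graph n} → X ⊆G Y → ∀ i j → adj X i j ≡ true → adj Y i j ≡ true
adj-mono {suc n} {v , X} {w , Y} X⊆Y zero    zero    ()
adj-mono {suc n} {v , X} {w , Y} X⊆Y zero    (suc j) = X⊆Y (inj₁ j)
adj-mono {suc n} {v , X} {w , Y} X⊆Y (suc i) zero    = X⊆Y (inj₁ i)
adj-mono {suc n} {v , X} {w , Y} X⊆Y (suc i) (suc j) = adj-mono (X⊆Y ∘ inj₂) i j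

HasOddCycle-mono : ∀ {n} {X Y : Graph n} → X ⊆G Y → HasOddCycle X → HasOddCycle Y
HasOddCycle-mono X⊆Y (t , c , c-injective , path , closing) =
  t , c , c-injective , adj-mono X⊆Y _ _ ∘ path , adj-mono X⊆Y _ _ closing

odd : ℕ → Bool
odd zero    = false
odd (suc m) = not (odd m)

odd-double : ∀ t → odd (t + t) ≡ false
odd-double zero    = refl
odd-double (suc t) rewrite +-suc t t = trans (not-involutive _) (odd-double t)

ProperColouring⇒¬HasOddCycle : ∀ {n} {X : Graph n} {χ} → ProperColouring X χ → ¬ HasOddCycle X
ProperColouring⇒¬HasOddCycle {X = X} {χ} proper (t , c , _ , path , closing) =
  adj-proper {χ = χ} proper _ _ closing (begin
    χ (c (fromℕ (suc (suc (t + t)))))      ≡⟨ alternates _ _ (toℕ-fromℕ _) ⟩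
    χ (c zero) xor not (not (odd (t + t))) ≡⟨ cong (χ (c zero) xor_) (trans (not-involutive _) (odd-double t)) ⟩
    χ (c zero) xor false                   ≡⟨ xor-identityʳ _ ⟩
    χ (c zero)                             ∎)
  where
  open ≡-Reasoning
  alternates : ∀ m k → toℕ k ≡ m → χ (c k) ≡ χ (c zero) xor odd m
  alternates zero    zero    _  = sym (xor-identityʳ _)
  alternates (suc m) (suc k) k≡ = begin
    χ (c (suc k))                   ≡⟨ ¬-not (adj-proper {χ = χ} proper _ _ (path k) ∘ sym) ⟩
    not (χ (c (inject₁ k)))         ≡⟨ cong not (alternates m (inject₁ k) (trans (toℕ-inject₁ k) (ℕₚ.suc-injective k≡))) ⟩
    not (χ (c zero) xor odd m)      ≡⟨ not-distribʳ-xor (χ (c zero)) (odd m) ⟩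
    χ (c zero) xor odd (suc m)      ∎

∈-agreement : ∀ {n} (G H : Graph n) f → (hasEdge (compl (G ⊕G H)) f ≡ true) ⇔ (hasEdge G f ≡ hasEdge H f)
∈-agreement G H f =
  subst (λ x → (x ≡ true) ⇔ (hasEdge G f ≡ hasEdge H f))
        (sym (trans (hasEdge-mapG not (G ⊕G H) f) (cong not (hasEdge-zipG _xor_ G H f))))
        (not-xor≡true⇔≡ (hasEdge G f) (hasEdge H f))
  where
  not-xor≡true⇔≡ : ∀ x y → (not (x xor y) ≡ true) ⇔ (x ≡ y)
  not-xor≡true⇔≡ false false = mk⇔ (λ _ → refl) (λ _ → refl)
  not-xor≡true⇔≡ false true  = mk⇔ (λ ()) (λ ())
  not-xor≡true⇔≡ true  false = mk⇔ (λ ()) (λ ())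
  not-xor≡true⇔≡ true  true  = mk⇔ (λ _ → refl) (λ _ → refl)

agreement-⊆ : ∀ {n} {G H G′ H′ : Graph n} →
              (∀ f → hasEdge G f ≡ hasEdge H f → hasEdge G′ f ≡ hasEdge H′ f) →
              compl (G ⊕G H) ⊆G compl (G′ ⊕G H′)
agreement-⊆ {G = G} {H} {G′} {H′} agree f p =
  from (∈-agreement G′ H′ f) (agree f (to (∈-agreement G H f) p))

agreement-¬HasOddCycle : ∀ {n} {G H : Graph n} (χ : Fin n → Bool) →
                         (∀ f → hasEdge G f ≡ hasEdge H f → χ separates f) →
                         ¬ HasOddCycle (compl (G ⊕G H))
agreement-¬HasOddCycle {G = G} {H} χ proper =
  ProperColouring⇒¬HasOddCycle {χ = χ} λ f p → proper f (to (∈-agreement G H f) p)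

-- Monotonization

module Monotonization {n} (e : Edge n) (F : Family n) where

  stays-or-moves : ∀ {A} → A ∈ F →
                   (shiftTo e F A ≡ A × addEdge A e ∈ F)
                   ⊎ (shiftTo e F A ≡ addEdge A e × hasEdge A e ≡ false × addEdge A e ∉ F)
  stays-or-moves {A} A∈F with hasEdge A e in h
  ... | true = inj₁ (refl , subst (_∈ F) (sym (addEdge-existing h)) A∈F)
  ... | false with memb (addEdge A e) F in m
  ...   | true  = inj₁ (refl , memb⇒∈ m)
  ...   | false = inj₂ (refl , refl , memb⇒∉ m)

  ∈Cmon⁻ : ∀ {B} → B ∈ Cmon e F →
           (B ∈ F × addEdge B e ∈ F) ⊎ (∃[ A ] A ∈ F × hasEdge A e ≡ false × B ≡ addEdge A e)
  ∈Cmon⁻ B∈ with ∈-map⁻ (shiftTo e F) B∈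
  ... | A , A∈F , refl with stays-or-moves A∈F
  ...   | inj₁ (stays , A+e∈F) rewrite stays = inj₁ (A∈F , A+e∈F)
  ...   | inj₂ (moves , e∉A , _) rewrite moves = inj₂ (A , A∈F , e∉A , refl)

  shiftTo-≢ : ∀ {A f} → f ≢ e → hasEdge (shiftTo e F A) f ≡ hasEdge A f
  shiftTo-≢ {A} f≢e with hasEdge A e | memb (addEdge A e) F
  ... | true  | _     = refl
  ... | false | true  = refl
  ... | false | false = hasEdge-addEdge-≢ A f≢e

  ∈Cmon-of-hasEdge : ∀ {A} → A ∈ F → hasEdge A e ≡ true → A ∈ Cmon e F
  ∈Cmon-of-hasEdge {A} A∈F e∈A = subst (_∈ Cmon e F) (stays e∈A) (∈-map⁺ (shiftTo e F) A∈F)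
    where
    stays : hasEdge A e ≡ true → shiftTo e F A ≡ A
    stays e∈A rewrite e∈A = refl

  ∈Cmon-lacking : ∀ {B} → B ∈ Cmon e F → hasEdge B e ≡ false → B ∈ F × addEdge B e ∈ F
  ∈Cmon-lacking B∈ e∉B with ∈Cmon⁻ B∈
  ... | inj₁ B∈F×B+e∈F        = B∈F×B+e∈F
  ... | inj₂ (A , _ , _ , refl) = contradiction (trans (sym e∉B) (hasEdge-addEdge-≡ A e)) λ ()

  ∈Cmon⇒∈⊎removeEdge∈ : ∀ {B} → B ∈ Cmon e F → B ∈ F ⊎ removeEdge B e ∈ F
  ∈Cmon⇒∈⊎removeEdge∈ B∈ with ∈Cmon⁻ B∈
  ... | inj₁ (B∈F , _)             = inj₁ B∈F
  ... | inj₂ (A , A∈F , e∉A , refl) = inj₂ (subst (_∈ F) (sym (removeEdge-addEdge e∉A)) A∈F)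

  ∈Cmon-addEdge : ∀ {B} → B ∈ Cmon e F → addEdge B e ∈ Cmon e F
  ∈Cmon-addEdge {B} B∈ with hasEdge B e in h
  ... | true  = subst (_∈ Cmon e F) (sym (addEdge-existing h)) B∈
  ... | false = ∈Cmon-of-hasEdge (proj₂ (∈Cmon-lacking B∈ h)) (hasEdge-addEdge-≡ B e)

  module _ (oca : OddCycleAgreeing F) where

    private
      witnessed : ∀ {X Y G H} → X ∈ F → Y ∈ F →
                  (∀ f → hasEdge X f ≡ hasEdge Y f → hasEdge G f ≡ hasEdge H f) →
                  HasOddCycle (compl (G ⊕G H))
      witnessed X∈F Y∈F agree = HasOddCycle-mono (agreement-⊆ agree) (oca _ _ X∈F Y∈F)

      moved-stayed : ∀ {A H} → A ∈ F → hasEdge A e ≡ false → addEdge H e ∈ F →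
                     HasOddCycle (compl (addEdge A e ⊕G H))
      moved-stayed {A} {H} A∈F e∉A H+e∈F = witnessed A∈F H+e∈F agree
        where
        agree : ∀ f → hasEdge A f ≡ hasEdge (addEdge H e) f → hasEdge (addEdge A e) f ≡ hasEdge H f
        agree f A≡H+e with f ≟E e
        ... | yes refl = contradiction (trans (sym e∉A) (trans A≡H+e (hasEdge-addEdge-≡ H e))) λ ()
        ... | no f≢e   = trans (hasEdge-addEdge-≢ A f≢e) (trans A≡H+e (hasEdge-addEdge-≢ H f≢e))

    Cmon-oddCycleAgreeing : OddCycleAgreeing (Cmon e F)
    Cmon-oddCycleAgreeing G H G∈ H∈ with ∈Cmon⁻ G∈ | ∈Cmon⁻ H∈
    ... | inj₁ (G∈F , _) | inj₁ (H∈F , _) = oca G H G∈F H∈F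
    ... | inj₂ (A , A∈F , _ , refl) | inj₂ (B , B∈F , _ , refl) =
      witnessed A∈F B∈F λ f → addEdge-preserves-agreement A B e
    ... | inj₂ (A , A∈F , e∉A , refl) | inj₁ (_ , H+e∈F) = moved-stayed A∈F e∉A H+e∈F
    ... | inj₁ (_ , G+e∈F) | inj₂ (B , B∈F , e∉B , refl) =
      HasOddCycle-mono (agreement-⊆ λ f → sym) (moved-stayed B∈F e∉B G+e∈F)

incident : ∀ {n} → Edge n → Fin n → Bool
incident e i = does (i Fin.≟ src e) ∨ does (i Fin.≟ dst e)

endpoint⇒incident : ∀ {n} {e : Edge n} {x} → x ≡ src e ⊎ x ≡ dst e → incident e x ≡ true
endpoint⇒incident {e = e} {x} x∈e with x Fin.≟ src e | x Fin.≟ dst e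
... | yes _    | _        = refl
... | no _     | yes _    = refl
... | no x≢src | no x≢dst = contradiction x∈e [ x≢src , x≢dst ]

incident⇒endpoint : ∀ {n} {e : Edge n} {x} → incident e x ≡ true → x ≡ src e ⊎ x ≡ dst e
incident⇒endpoint {e = e} {x} x∈e with x Fin.≟ src e | x Fin.≟ dst e
... | yes x≡src | _         = inj₁ x≡src
... | no _      | yes x≡dst = inj₂ x≡dst
... | no _      | no _      = contradiction x∈e λ ()

both-incident⇒≡ : ∀ {n} {e f : Edge n} → incident e (src f) ≡ true → incident e (dst f) ≡ true → f ≡ e
both-incident⇒≡ {e = e} {f} p q with incident⇒endpoint {e = e} p | incident⇒endpoint {e = e} q
... | inj₁ s≡s | inj₁ d≡s = contradiction (trans s≡s (sym d≡s)) (src≢dst f)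
... | inj₁ s≡s | inj₂ d≡d = src-dst-injective s≡s d≡d
... | inj₂ s≡d | inj₁ d≡s = contradiction (subst₂ Fin._<_ s≡d d≡s (src<dst f)) (<-asym (src<dst e))
... | inj₂ s≡d | inj₂ d≡d = contradiction (trans s≡d (sym d≡d)) (src≢dst f)

recolour : ∀ {n} → (Fin n → Bool) → Fin n → Fin n → Fin n → Bool
recolour χ x y i = if does (i Fin.≟ y) then not (χ x) else χ i

recolour-≢ : ∀ {n} (χ : Fin n → Bool) x {y i} → i ≢ y → recolour χ x y i ≡ χ i
recolour-≢ χ x {y} {i} i≢y with i Fin.≟ y
... | yes i≡y = contradiction i≡y i≢y
... | no _    = refl

recolour-separates : ∀ {n} (χ : Fin n → Bool) {x y} → x ≢ y → recolour χ x y x ≢ recolour χ x y y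
recolour-separates χ {x} {y} x≢y eq = not-¬ refl (trans (sym (recolour-≢ χ x x≢y)) (trans eq at-y))
  where
  at-y : recolour χ x y y ≡ not (χ x)
  at-y with y Fin.≟ y
  ... | yes _   = refl
  ... | no y≢y  = contradiction refl y≢y

module Triangle {n} (a b c : Fin n) where

  vertex-index : ∀ {x} → inTri a b c x ≡ true → ∃[ k ] x ≡ lookup (a ∷ b ∷ c ∷ []) k
  vertex-index {x} x∈ with x Fin.≟ a | x Fin.≟ b | x Fin.≟ c
  ... | yes x≡a | _       | _       = 0F , x≡a
  ... | no _    | yes x≡b | _       = 1F , x≡b
  ... | no _    | no _    | yes x≡c = 2F , x≡c
  ... | no _    | no _    | no _    = contradiction x∈ λ ()

  hasEdge-triangle : ∀ f → hasEdge (triangle a b c) f ≡ inTri a b c (src f) ∧ inTri a b c (dst f)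
  hasEdge-triangle = hasEdge-tabG (λ i j → inTri a b c i ∧ inTri a b c j)

  triangle-endpoints : ∀ {f} → hasEdge (triangle a b c) f ≡ true →
                       inTri a b c (src f) ≡ true × inTri a b c (dst f) ≡ true
  triangle-endpoints {f} f∈T = ∧-conicalˡ _ _ both , ∧-conicalʳ _ _ both
    where
    both : inTri a b c (src f) ∧ inTri a b c (dst f) ≡ true
    both = trans (sym (hasEdge-triangle f)) f∈T

  triangle-outside : ∀ {g} → hasEdge (triangle a b c) g ≡ false →
                     inTri a b c (src g) ≡ false ⊎ inTri a b c (dst g) ≡ false
  triangle-outside {g} g∉T with inTri a b c (src g) | trans (sym (hasEdge-triangle g)) g∉T
  ... | false | _     = inj₁ refl
  ... | true  | dst∉T = inj₂ dst∉T

  -- The pigeonhole principle for four vertices in a three-element set.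
  pairs-meet : ∀ {x y u v} →
    inTri a b c x ≡ true → inTri a b c y ≡ true → inTri a b c u ≡ true → inTri a b c v ≡ true →
    x ≢ y → u ≢ v → (x ≡ u ⊎ x ≡ v) ⊎ (y ≡ u ⊎ y ≡ v)
  pairs-meet {x} {y} {u} {v} x∈ y∈ u∈ v∈ x≢y u≢v =
    let i , j , i<j , same = pigeonhole (n<1+n 3) (proj₁ ∘ index) in
    shared i j (<⇒≢ i<j) (trans (proj₂ (index i)) (trans (cong (lookup (a ∷ b ∷ c ∷ [])) same) (sym (proj₂ (index j)))))
    where
    vertex : Fin 4 → Fin n
    vertex = lookup (x ∷ y ∷ u ∷ v ∷ [])

    index : ∀ i → ∃[ k ] vertex i ≡ lookup (a ∷ b ∷ c ∷ []) k
    index 0F = vertex-index x∈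
    index 1F = vertex-index y∈
    index 2F = vertex-index u∈
    index 3F = vertex-index v∈

    shared : ∀ i j → i ≢ j → vertex i ≡ vertex j → (x ≡ u ⊎ x ≡ v) ⊎ (y ≡ u ⊎ y ≡ v)
    shared 0F 0F i≢j _ = contradiction refl i≢j
    shared 1F 1F i≢j _ = contradiction refl i≢j
    shared 2F 2F i≢j _ = contradiction refl i≢j
    shared 3F 3F i≢j _ = contradiction refl i≢j
    shared 0F 1F _ p = contradiction p x≢y
    shared 1F 0F _ p = contradiction (sym p) x≢y
    shared 2F 3F _ p = contradiction p u≢v
    shared 3F 2F _ p = contradiction (sym p) u≢v
    shared 0F 2F _ p = inj₁ (inj₁ p)
    shared 2F 0F _ p = inj₁ (inj₁ (sym p))
    shared 0F 3F _ p = inj₁ (inj₂ p)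
    shared 3F 0F _ p = inj₁ (inj₂ (sym p))
    shared 1F 2F _ p = inj₂ (inj₁ p)
    shared 2F 1F _ p = inj₂ (inj₁ (sym p))
    shared 1F 3F _ p = inj₂ (inj₂ p)
    shared 3F 1F _ p = inj₂ (inj₂ (sym p))

  -- Two distinct edges of a triangle share exactly one vertex, so T − e is 2-coloured
  -- by incidence with e.
  incident-separates : ∀ {e f} → hasEdge (triangle a b c) e ≡ true →
                       hasEdge (triangle a b c) f ≡ true → f ≢ e → incident e separates f
  incident-separates {e} {f} e∈T f∈T f≢e =
    exactly-one (Sum.map (endpoint⇒incident {e = e}) (endpoint⇒incident {e = e})
                   (pairs-meet (proj₁ fT) (proj₂ fT) (proj₁ eT) (proj₂ eT) (src≢dst f) (src≢dst e)))
                λ p q → f≢e (both-incident⇒≡ p q)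
    where
    fT : inTri a b c (src f) ≡ true × inTri a b c (dst f) ≡ true
    fT = triangle-endpoints f∈T
    eT : inTri a b c (src e) ≡ true × inTri a b c (dst e) ≡ true
    eT = triangle-endpoints e∈T
    exactly-one : ∀ {x y} → x ≡ true ⊎ y ≡ true → (x ≡ true → y ≡ true → ⊥) → x ≢ y
    exactly-one {true}  {true}  _         not-both _ = not-both refl refl
    exactly-one {true}  {false} _         _        ()
    exactly-one {false} {true}  _         _        ()
    exactly-one {false} {false} (inj₁ ()) _        _
    exactly-one {false} {false} (inj₂ ()) _        _

  recoloured-incidence-separates : ∀ {e} x {y} → hasEdge (triangle a b c) e ≡ true → inTri a b c y ≡ false →
    ∀ f → hasEdge (triangle a b c) f ≡ true → f ≢ e → recolour (incident e) x y separates f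
  recoloured-incidence-separates {e} x {y} e∈T y∉T f f∈T f≢e =
    subst₂ _≢_ (sym (recolour-≢ (incident e) x (avoids (src f) (proj₁ (triangle-endpoints f∈T)))))
               (sym (recolour-≢ (incident e) x (avoids (dst f) (proj₂ (triangle-endpoints f∈T)))))
               (incident-separates e∈T f∈T f≢e)
    where
    avoids : ∀ z → inTri a b c z ≡ true → z ≢ y
    avoids _ z∈T refl = contradiction (trans (sym z∈T) y∉T) λ ()

  -- (T − e) + g is bipartite for g ∉ T: recolour an endpoint of g lying off the triangle.
  minus-edge-plus-colouring : ∀ {e g} → hasEdge (triangle a b c) e ≡ true → hasEdge (triangle a b c) g ≡ false →
    Σ[ χ ∈ (Fin n → Bool) ] (∀ f → hasEdge (triangle a b c) f ≡ true → f ≢ e → χ separates f) × χ separates g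
  minus-edge-plus-colouring {e} {g} e∈T g∉T with triangle-outside g∉T
  ... | inj₂ dst∉T = recolour (incident e) (src g) (dst g) ,
                     recoloured-incidence-separates (src g) e∈T dst∉T ,
                     recolour-separates (incident e) (src≢dst g)
  ... | inj₁ src∉T = recolour (incident e) (dst g) (src g) ,
                     recoloured-incidence-separates (dst g) e∈T src∉T ,
                     recolour-separates (incident e) (src≢dst g ∘ sym) ∘ sym

-- Pulling a junta back along a monotonization

Cmon-junta-∉ : ∀ {n} {T S : Graph n} {e F} → hasEdge T e ≡ false → Junta T S (Cmon e F) → Junta T S F
Cmon-junta-∉ {T = T} {S} {e} {F} e∉T junta G = mk⇔ to′ from′
  where
  open Monotonization e F

  to′ : G ∈ F → G ≈[ T ] S
  to′ G∈F = ≈-trans (≈-off e∉T λ f f≢e → sym (shiftTo-≢ f≢e)) (to (junta _) (∈-map⁺ (shiftTo e F) G∈F))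

  from′ : G ≈[ T ] S → G ∈ F
  from′ G≈S = subst (_∈ F) restore (both (hasEdge G e))
    where
    R : Graph _
    R = removeEdge G e
    R∈F×R+e∈F : R ∈ F × addEdge R e ∈ F
    R∈F×R+e∈F = ∈Cmon-lacking (from (junta R) (≈-trans (setEdge-≈ G false e∉T) G≈S)) (hasEdge-setEdge-≡ G e false)
    both : ∀ b → setEdge R e b ∈ F
    both true  = subst (_∈ F) (addEdge≡setEdge R e) (proj₂ R∈F×R+e∈F)
    both false = subst (_∈ F) (sym (setEdge-setEdge G e false false)) (proj₁ R∈F×R+e∈F)
    restore : setEdge R e (hasEdge G e) ≡ G
    restore = trans (setEdge-setEdge G e false _) (setEdge-hasEdge G e)

Cmon-junta-hasEdge : ∀ {n} {T S : Graph n} {e F} → hasEdge T e ≡ true → Junta T S (Cmon e F) → hasEdge S e ≡ true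
Cmon-junta-hasEdge {S = S} {e} {F} e∈T junta =
  trans (sym (to (junta _) (∈Cmon-addEdge (from (junta S) ≈-refl)) e e∈T)) (hasEdge-addEdge-≡ S e)
  where open Monotonization e F

module EdgeInTriangle {n} {F : Family n} (oca : OddCycleAgreeing F) {a b c : Fin n} {e : Edge n} {S : Graph n}
         (e∈T : hasEdge (triangle a b c) e ≡ true) (junta : Junta (triangle a b c) S (Cmon e F)) where

  open Monotonization e F
  open Triangle a b c

  T : Graph n
  T = triangle a b c

  e∈S : hasEdge S e ≡ true
  e∈S = Cmon-junta-hasEdge e∈T junta

  ≈S⇒hasEdge : ∀ {G} → G ≈[ T ] S → hasEdge G e ≡ true
  ≈S⇒hasEdge G≈S = trans (G≈S e e∈T) e∈S

  ≈S-disagrees-removeEdge : ∀ {G} H → G ≈[ T ] S → hasEdge G e ≢ hasEdge (removeEdge H e) e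
  ≈S-disagrees-removeEdge H G≈S G≡H-e =
    contradiction (trans (sym (≈S⇒hasEdge G≈S)) (trans G≡H-e (hasEdge-setEdge-≡ H e false))) λ ()

  ≈S⇒∈F⊎ : ∀ {G} → G ≈[ T ] S → G ∈ F ⊎ removeEdge G e ∈ F
  ≈S⇒∈F⊎ {G} G≈S = ∈Cmon⇒∈⊎removeEdge∈ (from (junta G) G≈S)

  ∈F⇒≈S : ∀ {A} → A ∈ F → hasEdge A e ≡ true → A ≈[ T ] S
  ∈F⇒≈S {A} A∈F e∈A = to (junta A) (∈Cmon-of-hasEdge A∈F e∈A)

  shiftTo-≈S : ∀ {A} → A ∈ F → shiftTo e F A ≈[ T ] S
  shiftTo-≈S A∈F = to (junta _) (∈-map⁺ (shiftTo e F) A∈F)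

  ∈F-lacking : ∀ {A} → A ∈ F → hasEdge A e ≡ false → addEdge A e ≈[ T ] S × addEdge A e ∉ F
  ∈F-lacking {A} A∈F e∉A with stays-or-moves A∈F
  ... | inj₁ (stays , _) =
    contradiction (trans (sym e∉A) (≈S⇒hasEdge (subst (_≈[ T ] S) stays (shiftTo-≈S A∈F)))) λ ()
  ... | inj₂ (moves , _ , A+e∉F) = subst (_≈[ T ] S) moves (shiftTo-≈S A∈F) , A+e∉F

  agreement-with-flipOutside : ∀ {G f} → G ≈[ T ] S →
    hasEdge G f ≡ hasEdge (removeEdge (flipOutside T G) e) f → hasEdge T f ≡ true × f ≢ e
  agreement-with-flipOutside {G} {f} G≈S agree with f ≟E e | hasEdge T f in f∈T
  ... | yes refl | _     = contradiction agree (≈S-disagrees-removeEdge _ G≈S)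
  ... | no f≢e   | true  = refl , f≢e
  ... | no f≢e   | false = contradiction
    (trans agree (trans (hasEdge-setEdge-≢ _ false f≢e) (flipOutside-∉ G f∈T))) (not-¬ refl)

  agreement-with-flipEdge : ∀ {G g f} → G ≈[ T ] S →
    hasEdge (flipOutside T G) f ≡ hasEdge (removeEdge (flipEdge G g) e) f → f ≡ g ⊎ (hasEdge T f ≡ true × f ≢ e)
  agreement-with-flipEdge {G} {g} {f} G≈S agree with f ≟E e | f ≟E g | hasEdge T f in f∈T
  ... | yes refl | _        | _     = contradiction agree (≈S-disagrees-removeEdge _ (≈-trans (flipOutside-≈ G) G≈S))
  ... | no _     | yes f≡g  | _     = inj₁ f≡g
  ... | no f≢e   | no _     | true  = inj₂ (refl , f≢e)
  ... | no f≢e   | no f≢g   | false = contradiction (sym (begin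
    not (hasEdge G f)                       ≡⟨ sym (flipOutside-∉ G f∈T) ⟩
    hasEdge (flipOutside T G) f             ≡⟨ agree ⟩
    hasEdge (removeEdge (flipEdge G g) e) f ≡⟨ hasEdge-setEdge-≢ _ false f≢e ⟩
    hasEdge (flipEdge G g) f                ≡⟨ hasEdge-setEdge-≢ G _ f≢g ⟩
    hasEdge G f                             ∎)) (not-¬ refl)
    where open ≡-Reasoning

  -- Ḡ agrees with G exactly on T.  If Ḡ, or G with g flipped, were not in F, its e-less
  -- version would be, and its agreement graph with G, resp. Ḡ, would lie in the
  -- bipartite graph T − e, resp. (T − e) + g.
  ∈F-flipEdge : ∀ {G} g → hasEdge T g ≡ false → G ∈ F → G ≈[ T ] S → flipEdge G g ∈ F
  ∈F-flipEdge {G} g g∉T G∈F G≈S =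
    [ id , ⊥-elim ∘ ¬flipEdge-removed ]′ (≈S⇒∈F⊎ (≈-trans (setEdge-≈ G _ g∉T) G≈S))
    where
    Ḡ : Graph n
    Ḡ = flipOutside T G

    ¬flipOutside-removed : removeEdge Ḡ e ∉ F
    ¬flipOutside-removed Ḡ-e∈F = agreement-¬HasOddCycle (incident e)
      (λ f agree → let f∈T , f≢e = agreement-with-flipOutside G≈S agree in incident-separates e∈T f∈T f≢e)
      (oca G _ G∈F Ḡ-e∈F)

    Ḡ∈F : Ḡ ∈ F
    Ḡ∈F = [ id , ⊥-elim ∘ ¬flipOutside-removed ]′ (≈S⇒∈F⊎ (≈-trans (flipOutside-≈ G) G≈S))

    ¬flipEdge-removed : removeEdge (flipEdge G g) e ∉ F
    ¬flipEdge-removed G′-e∈F with minus-edge-plus-colouring e∈T g∉T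
    ... | χ , T-e-separated , g-separated = agreement-¬HasOddCycle χ
      (λ f agree → [ (λ { refl → g-separated }) , (λ (f∈T , f≢e) → T-e-separated f f∈T f≢e) ]
                     (agreement-with-flipEdge G≈S agree))
      (oca Ḡ _ Ḡ∈F G′-e∈F)

  ≈S-closed : ∀ {G H} → G ∈ F → G ≈[ T ] S → H ≈[ T ] S → H ∈ F
  ≈S-closed G∈F G≈S H≈S = proj₁ (≈-closed T P step (G∈F , G≈S) (≈-trans H≈S (≈-sym G≈S)))
    where
    P : Graph n → Set
    P G = G ∈ F × G ≈[ T ] S
    step : ∀ {G} g → hasEdge T g ≡ false → P G → P (flipEdge G g)
    step {G} g g∉T (G∈F , G≈S) = ∈F-flipEdge g g∉T G∈F G≈S , ≈-trans (setEdge-≈ G _ g∉T) G≈S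

  all-members : S ∈ F → Junta T S F
  all-members S∈F G = mk⇔ ∈F⇒≈S′ (≈S-closed S∈F ≈-refl)
    where
    ∈F⇒≈S′ : G ∈ F → G ≈[ T ] S
    ∈F⇒≈S′ G∈F with hasEdge G e in e∈G
    ... | true  = ∈F⇒≈S G∈F e∈G
    ... | false = let G+e≈S , G+e∉F = ∈F-lacking G∈F e∈G in
                  contradiction (≈S-closed S∈F ≈-refl G+e≈S) G+e∉F

  no-members : S ∉ F → Junta T (removeEdge S e) F
  no-members S∉F G = mk⇔ ∈F⇒≈S-e ≈S-e⇒∈F
    where
    ≈S⇒∉F : ∀ {H} → H ≈[ T ] S → H ∉ F
    ≈S⇒∉F H≈S H∈F = S∉F (≈S-closed H∈F H≈S ≈-refl)

    ∈F⇒≈S-e : G ∈ F → G ≈[ T ] removeEdge S e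
    ∈F⇒≈S-e G∈F with hasEdge G e in e∈G
    ... | true  = contradiction G∈F (≈S⇒∉F (∈F⇒≈S G∈F e∈G))
    ... | false = removeEdge-≈ e∈G (proj₁ (∈F-lacking G∈F e∈G))

    ≈S-e⇒∈F : G ≈[ T ] removeEdge S e → G ∈ F
    ≈S-e⇒∈F G≈S-e with ≈S⇒∈F⊎ (addEdge-≈ e∈S G≈S-e)
    ... | inj₁ G+e∈F   = contradiction G+e∈F (≈S⇒∉F (addEdge-≈ e∈S G≈S-e))
    ... | inj₂ G+e-e∈F =
      subst (_∈ F) (removeEdge-addEdge (trans (G≈S-e e e∈T) (hasEdge-setEdge-≡ S e false))) G+e-e∈F

  pullback : ∃[ S′ ] Junta T S′ F
  pullback with memb S F in m
  ... | true  = S , all-members (memb⇒∈ m)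
  ... | false = removeEdge S e , no-members (memb⇒∉ m)

Cmon-junta-pullback : ∀ {n} {F : Family n} {a b c : Fin n} {e S} → OddCycleAgreeing F →
                      Junta (triangle a b c) S (Cmon e F) → ∃[ S′ ] Junta (triangle a b c) S′ F
Cmon-junta-pullback {a = a} {b} {c} {e} {S} oca junta with hasEdge (triangle a b c) e in e∈T
... | false = S , Cmon-junta-∉ e∈T junta
... | true  = EdgeInTriangle.pullback oca e∈T junta

iterC-junta-pullback : ∀ {n} {F : Family n} {a b c : Fin n} es {S} → OddCycleAgreeing F →
                       Junta (triangle a b c) S (iterC es F) → ∃[ S′ ] Junta (triangle a b c) S′ F
iterC-junta-pullback []       oca junta = _ , junta
iterC-junta-pullback {F = F} (e ∷ es) oca junta =
  let _ , junta₁ = iterC-junta-pullback es (Monotonization.Cmon-oddCycleAgreeing e F oca) junta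
  in Cmon-junta-pullback oca junta₁

lemma2p3 : (n : ℕ) (F : Family n) (es : List (Edge n)) →
    OddCycleAgreeing F →
    IsTriangleUmvirate (iterC es F) →
    IsTriangleJunta F
lemma2p3 n F es oca (a , b , c , triangle-abc , umvirate) =
  let S , junta = iterC-junta-pullback es oca (λ G → ⊆⇔≈ ⇔-∘ umvirate G)
  in a , b , c , triangle-abc , S ∩G triangle a b c , ∩-⊆ S (triangle a b c) , λ G → ≈⇔∩≡ ⇔-∘ junta G
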